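{- Let $n\ge 1$ and let $A,B\in\mathbb{Y}_n$ be Young diagrams such that there is an $n$-flip between $A$ and $B$. Then for every $k$ such that $A,B\in\mathbb{Y}_k$ there is also a $k$-flip between $A$ and $B$; in particular there is a $k$-flip between $A$ and $B$ for every $k>n$.
   Context: A Young diagram is identified with a partition $D=(d_1,d_2,\dots)$, $d_1\ge d_2\ge\dots\ge 0$ integers, only finitely many nonzero; it is drawn in the fourth quadrant with row $k$ occupying $[0,d_k]\times[-k,-k+1]$. For $n\ge 1$, $\mathbb{Y}_n$ is the set of Young diagrams lying inside the triangle bounded by the coordinate axes and the line $y=x-n$, i.e. those with $d_k\le n-k$ for $1\le k\le n-1$ and $d_k=0$ for $k\ge n$. For $m\ge 3$, label the vertices of a convex $m$-gon $0,1,\dots,m-1$ counterclockwise. A triangulation is a set of diagonals, pairwise either sharing an endpoint or non-intersecting, that divides the polygon into triangles (it has $m-3$ diagonals); $T_m$ denotes the set of triangulations of the $m$-gon. The tail (resp. head) of a diagonal is its smaller (resp. larger) endpoint. For $A\in T_{n+2}$, $\Lambda_{n+2}(A)=(\lambda_1,\dots,\lambda_{n-1},0,0,\dots)$ where $\lambda_1\ge\dots\ge\lambda_{n-1}$ are the tails of the $n-1$ diagonals of $A$ listed in decreasing order; $\Lambda_{n+2}$ is a bijection $T_{n+2}\to\mathbb{Y}_n$. A flip of a triangulation removes one diagonal and replaces it by the other diagonal of the resulting quadrilateral; equivalently, two triangulations are related by a flip iff they differ in exactly one diagonal. For $A,B\in\mathbb{Y}_n$, there is an $n$-flip between $A$ and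 $B$ if $\Lambda_{n+2}^{ -1}(A)$ and $\Lambda_{n+2}^{ -1}(B)$ are related by a flip. -}

module Defs where

open import Data.Nat using (ℕ; zero; suc; _+_; _∸_; _≤_; _<_)
open import Data.Nat.Properties using (≤-decTotalOrder)
open import Data.Product using (Σ; _×_; _,_; proj₁; proj₂; ∃)
open import Data.List using (List; []; _∷_; map; reverse; length)
open import Data.List.Membership.Propositional using (_∈_; _∉_)
open import Data.List.Relation.Unary.All using (All)
open import Data.List.Relation.Unary.Unique.Propositional using (Unique)
open import Data.List.Sort ≤-decTotalOrder using (sort)
open import Data.Sum using (_⊎_)
open import Relation.Binary.PropositionalEquality using (_≡_; _≢_)
open import Relation.Nullary using (¬_)

-- Young diagram D = (d₁, d₂, …): the field `d` is 0-indexed,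
-- i.e. `d i` is the length of row i+1 (d_{i+1} in the paper).
record YoungDiagram : Set where
  field
    d       : ℕ → ℕ
    mono    : ∀ i → d (suc i) ≤ d i
    finite  : ∃ λ N → ∀ i → N ≤ i → d i ≡ 0
open YoungDiagram public

-- D ∈ 𝕐_n : d_k ≤ n - k for 1 ≤ k ≤ n-1, and d_k = 0 for k ≥ n
-- (with k = i + 1).
InY : ℕ → YoungDiagram → Set
InY n D = (∀ i → suc i ≤ n ∸ 1 → d D i ≤ n ∸ suc i)
        × (∀ i → n ≤ suc i → d D i ≡ 0)

-- A diagonal of the convex m-gon with vertices 0,…,m-1 is a pair
-- (tail , head) with tail < head, not adjacent vertices.
IsDiagonal : ℕ → ℕ × ℕ → Set
IsDiagonal m (i , j) = (i + 2 ≤ j) × (j < m) × ¬ ((i ≡ 0) × (suc j ≡ m))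

Cross : ℕ × ℕ → ℕ × ℕ → Set
Cross (a , b) (c , e) = (a < c × c < b × b < e) ⊎ (c < a × a < e × e < b)

IsTriangulation : ℕ → List (ℕ × ℕ) → Set
IsTriangulation m T =
  All (IsDiagonal m) T × Unique T
  × (∀ {x y} → x ∈ T → y ∈ T → ¬ Cross x y)
  × (length T ≡ m ∸ 3)

Flip : List (ℕ × ℕ) → List (ℕ × ℕ) → Set
Flip T U = Σ (ℕ × ℕ) λ x → Σ (ℕ × ℕ) λ y →
    x ∈ T × x ∉ U × y ∈ U × y ∉ T
  × (∀ e → e ∈ T → e ≢ x → e ∈ U)
  × (∀ e → e ∈ U → e ≢ y → e ∈ T)

nth0 : List ℕ → ℕ → ℕ
nth0 []       _       = 0
nth0 (x ∷ xs) zero    = x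
nth0 (x ∷ xs) (suc i) = nth0 xs i

-- Λ(T): tails of the diagonals in decreasing order, padded with zeros
-- (0-indexed as for YoungDiagram.d).
Λ : List (ℕ × ℕ) → ℕ → ℕ
Λ T = nth0 (reverse (sort (map proj₁ T)))

-- There is an n-flip between A and B: Λ_{n+2}^{-1}(A) and
-- Λ_{n+2}^{-1}(B) are related by a flip.
NFlip : ℕ → YoungDiagram → YoungDiagram → Set
NFlip n A B = Σ (List (ℕ × ℕ)) λ T → Σ (List (ℕ × ℕ)) λ U →
    IsTriangulation (n + 2) T × IsTriangulation (n + 2) U
  × (∀ i → Λ T i ≡ d A i) × (∀ i → Λ U i ≡ d B i)
  × Flip T U

module Submission where

-- Everything rests on the diagonal z = (0 , n+1) cutting off the ear at the
-- last vertex n+2 of the (n+3)-gon.  Growing: adding z to a triangulation of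
-- the (n+2)-gon triangulates the (n+3)-gon, keeps Λ (a tail 0 is only
-- padding) and keeps flips, so n-flips are (n+1)-flips.  Shrinking: if T
-- triangulates the (n+3)-gon and Λ(T) ∈ 𝕐_n, then z ∈ T.  Otherwise either
-- no diagonal ends at n+2, and T with z are too many non-crossing chords on
-- 0,…,n+1; or a diagonal (a , n+2) with least a ≥ 1 exists, fewer than a
-- diagonals have tail < a, and the many tails ≥ a push a row of Λ(T) out of
-- the triangle of 𝕐_n.  Removing z, an (n+1)-flip between diagrams of 𝕐_n
-- becomes an n-flip.  Both counts use the bound "at most hi-lo-1 pairwise
-- non-crossing chords on lo,…,hi".

open import Defs
open import Data.Nat using (ℕ; zero; suc; _+_; _∸_; _≤_; _<_; _≤′_; ≤′-refl; ≤′-step; z≤n; s≤s; _≤?_; _≟_)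
open import Data.Nat.Properties
open import Data.Product using (_×_; _,_; proj₁; proj₂; ∃)
open import Data.Product.Properties using (≡-dec)
open import Data.Sum using (_⊎_; inj₁; inj₂)
import Data.Sum as Sum
open import Data.List using (List; []; _∷_; map; reverse; length; _++_; [_]; filter)
open import Data.List.Properties using (filter-accept; filter-reject; filter-none; unfold-reverse)
open import Data.List.Sort ≤-decTotalOrder using (sort; sort-↭; sort-↗)
open import Data.List.Membership.Propositional using (_∈_; _∉_)
open import Data.List.Membership.Propositional.Properties using (∈-filter⁻; ∈-∃++)
open import Data.List.Membership.DecPropositional (≡-dec _≟_ _≟_) using (_∈?_)
open import Data.List.Relation.Unary.Any using (here; there)
open import Data.List.Relation.Unary.All as All using (All; []; _∷_)
open import Data.List.Relation.Unary.All.Properties using (¬Any⇒All¬)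
open import Data.List.Relation.Unary.AllPairs using (AllPairs; []; _∷_)
import Data.List.Relation.Unary.AllPairs.Properties as AllPairs
open import Data.List.Relation.Unary.Linked using ([-]; _∷_)
open import Data.List.Relation.Unary.Unique.Propositional using (Unique) renaming (tail to Unique-tail)
import Data.List.Relation.Unary.Unique.Propositional.Properties as Unique
open import Data.List.Relation.Unary.Sorted.TotalOrder ≤-totalOrder using (Sorted)
open import Data.List.Relation.Unary.Sorted.TotalOrder.Properties using (↗↭↗⇒≋; Sorted⇒AllPairs)
open import Data.List.Relation.Binary.Equality.Propositional using (≋⇒≡)
open import Data.List.Relation.Binary.Permutation.Propositional using (_↭_; ↭-sym; ↭-trans; prep; ↭⇒↭ₛ)
open import Data.List.Relation.Binary.Permutation.Propositional.Properties
  using (map⁺; shift; ∈-resp-↭; All-resp-↭; ↭-length; ↭-reverse; filter-↭)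
open import Relation.Nullary using (¬_; yes; no; ¬?)
open import Relation.Unary using (Decidable)
open import Data.Empty using (⊥; ⊥-elim)
open import Function using (_∘_)
open import Relation.Binary.PropositionalEquality hiding ([_])
open import Data.List.Relation.Binary.Permutation.Setoid.Properties (setoid (ℕ × ℕ)) using (Unique-resp-↭)

sorted-↭-unique : ∀ {xs ys} → Sorted xs → Sorted ys → xs ↭ ys → xs ≡ ys
sorted-↭-unique xs↗ ys↗ xs↭ys = ≋⇒≡ (↗↭↗⇒≋ ≤-totalOrder xs↗ ys↗ (↭⇒↭ₛ xs↭ys))

sort-resp-↭ : ∀ {xs ys} → xs ↭ ys → sort xs ≡ sort ys
sort-resp-↭ {xs} {ys} xs↭ys = sorted-↭-unique (sort-↗ xs) (sort-↗ ys)
  (↭-trans (sort-↭ xs) (↭-trans xs↭ys (↭-sym (sort-↭ ys))))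

sort-zero : ∀ xs → sort (0 ∷ xs) ≡ 0 ∷ sort xs
sort-zero xs = sorted-↭-unique (sort-↗ (0 ∷ xs)) (zero-first (sort-↗ xs))
  (↭-trans (sort-↭ (0 ∷ xs)) (prep 0 (↭-sym (sort-↭ xs))))
  where
  zero-first : ∀ {ys} → Sorted ys → Sorted (0 ∷ ys)
  zero-first {[]}    _   = [-]
  zero-first {_ ∷ _} ys↗ = z≤n ∷ ys↗

Λ-resp-↭ : ∀ {T U} → T ↭ U → ∀ i → Λ T i ≡ Λ U i
Λ-resp-↭ T↭U i = cong (λ s → nth0 (reverse s) i) (sort-resp-↭ (map⁺ proj₁ T↭U))

-- nth0 already pads with zeros, so a trailing zero is invisible.
nth0-pad : ∀ xs i → nth0 (xs ++ [ 0 ]) i ≡ nth0 xs i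
nth0-pad []       zero    = refl
nth0-pad []       (suc i) = refl
nth0-pad (x ∷ xs) zero    = refl
nth0-pad (x ∷ xs) (suc i) = nth0-pad xs i

Λ-tail-zero : ∀ y T i → Λ ((0 , y) ∷ T) i ≡ Λ T i
Λ-tail-zero y T i = begin
  nth0 (reverse (sort (0 ∷ tails))) i   ≡⟨ cong (λ s → nth0 (reverse s) i) (sort-zero tails) ⟩
  nth0 (reverse (0 ∷ sort tails)) i     ≡⟨ cong (λ s → nth0 s i) (unfold-reverse 0 (sort tails)) ⟩
  nth0 (reverse (sort tails) ++ [ 0 ]) i ≡⟨ nth0-pad (reverse (sort tails)) i ⟩
  Λ T i                                 ∎
  where
  open ≡-Reasoning
  tails = map proj₁ T

length-filter-map : ∀ {A B : Set} {P : B → Set} (P? : Decidable P) (f : A → B) xs →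
  length (filter P? (map f xs)) ≡ length (filter (P? ∘ f) xs)
length-filter-map P? f []       = refl
length-filter-map P? f (x ∷ xs) with P? (f x)
... | yes _ = cong suc (length-filter-map P? f xs)
... | no  _ = length-filter-map P? f xs

decreasing-nth : ∀ a c {xs} → AllPairs (λ x y → y ≤ x) xs →
  c < length (filter (a ≤?_) xs) → a ≤ nth0 xs c
decreasing-nth a c {x ∷ xs} (x≥xs ∷ dec) c<count with a ≤? x
decreasing-nth a zero    {x ∷ xs} _           _       | yes a≤x = a≤x
decreasing-nth a (suc c) {x ∷ xs} (_ ∷ dec) c<count | yes a≤x
  rewrite filter-accept (a ≤?_) {x} {xs} a≤x = decreasing-nth a c dec (≤-pred c<count)
decreasing-nth a c       {x ∷ xs} (x≥xs ∷ _) c<count | no a≰x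
  rewrite filter-reject (a ≤?_) {x} {xs} a≰x
        | filter-none (a ≤?_) (All.map (λ y≤x a≤y → a≰x (≤-trans a≤y y≤x)) x≥xs)
  with () ← c<count

AllPairs-reverse : ∀ {A : Set} {R : A → A → Set} {xs} → AllPairs R xs → AllPairs (λ x y → R y x) (reverse xs)
AllPairs-reverse []                    = []
AllPairs-reverse {xs = x ∷ xs} (Rx ∷ Rxs) rewrite unfold-reverse x xs =
  AllPairs.++⁺ (AllPairs-reverse Rxs) ([] ∷ [])
    (All-resp-↭ (↭-sym (↭-reverse xs)) (All.map (_∷ []) Rx))

Λ-lower-bound : ∀ a c T → c < length (filter (λ p → a ≤? proj₁ p) T) → a ≤ Λ T c
Λ-lower-bound a c T c<count = decreasing-nth a c decreasing (begin-strict
  c                                           <⟨ c<count ⟩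
  length (filter (λ p → a ≤? proj₁ p) T)      ≡⟨ length-filter-map (a ≤?_) proj₁ T ⟨
  length (filter (a ≤?_) tails)               ≡⟨ ↭-length (filter-↭ (a ≤?_) reordering) ⟩
  length (filter (a ≤?_) (reverse (sort tails))) ∎)
  where
  open ≤-Reasoning
  tails = map proj₁ T
  reordering : tails ↭ reverse (sort tails)
  reordering = ↭-trans (↭-sym (sort-↭ tails)) (↭-sym (↭-reverse (sort tails)))
  decreasing : AllPairs (λ x y → y ≤ x) (reverse (sort tails))
  decreasing = AllPairs-reverse (Sorted⇒AllPairs ≤-totalOrder (sort-↗ tails))

∈⇒↭-front : ∀ {A : Set} {x : A} {xs} → x ∈ xs → ∃ λ ys → xs ↭ x ∷ ys
∈⇒↭-front x∈xs with ys , zs , refl ← ∈-∃++ x∈xs = ys ++ zs , shift _ ys zs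

NonCrossing : List (ℕ × ℕ) → Set
NonCrossing S = ∀ {p q} → p ∈ S → q ∈ S → ¬ Cross p q

NonCrossing-resp-↭ : ∀ {S S′} → S ↭ S′ → NonCrossing S → NonCrossing S′
NonCrossing-resp-↭ S↭S′ nc p∈ q∈ = nc (∈-resp-↭ (↭-sym S↭S′) p∈) (∈-resp-↭ (↭-sym S↭S′) q∈)

NonCrossing-filter : ∀ {P : ℕ × ℕ → Set} (P? : Decidable P) {S} → NonCrossing S → NonCrossing (filter P? S)
NonCrossing-filter P? nc p∈ q∈ = nc (proj₁ (∈-filter⁻ P? p∈)) (proj₁ (∈-filter⁻ P? q∈))

IsTriangulation-resp-↭ : ∀ {m T U} → T ↭ U → IsTriangulation m T → IsTriangulation m U
IsTriangulation-resp-↭ T↭U (diagonals , unique , nc , count) =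
  All-resp-↭ T↭U diagonals , Unique-resp-↭ (↭⇒↭ₛ T↭U) unique ,
  NonCrossing-resp-↭ T↭U nc , trans (sym (↭-length T↭U)) count

Flip-resp-↭ : ∀ {T T′ U U′} → T ↭ T′ → U ↭ U′ → Flip T U → Flip T′ U′
Flip-resp-↭ T↭T′ U↭U′ (x , y , x∈T , x∉U , y∈U , y∉T , T⊆U , U⊆T) =
  x , y , to T↭T′ x∈T , x∉U ∘ from U↭U′ , to U↭U′ y∈U , y∉T ∘ from T↭T′ ,
  (λ e e∈ e≢x → to U↭U′ (T⊆U e (from T↭T′ e∈) e≢x)) ,
  (λ e e∈ e≢y → to T↭T′ (U⊆T e (from U↭U′ e∈) e≢y))
  where
  to : ∀ {V W e} → V ↭ W → e ∈ V → e ∈ W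
  to = ∈-resp-↭
  from : ∀ {V W e} → V ↭ W → e ∈ W → e ∈ V
  from σ = ∈-resp-↭ (↭-sym σ)

Flip-cons : ∀ {z T U} → z ∉ T → z ∉ U → Flip T U → Flip (z ∷ T) (z ∷ U)
Flip-cons z∉T z∉U (x , y , x∈T , x∉U , y∈U , y∉T , T⊆U , U⊆T) =
  x , y , there x∈T , x∉z∷U , there y∈U , y∉z∷T , z∷T⊆z∷U , z∷U⊆z∷T
  where
  x∉z∷U : x ∉ _ ∷ _
  x∉z∷U (here refl) = z∉T x∈T
  x∉z∷U (there x∈U) = x∉U x∈U
  y∉z∷T : y ∉ _ ∷ _
  y∉z∷T (here refl) = z∉U y∈U
  y∉z∷T (there y∈T) = y∉T y∈T
  z∷T⊆z∷U : ∀ e → e ∈ _ ∷ _ → e ≢ x → e ∈ _ ∷ _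
  z∷T⊆z∷U e (here e≡z) _    = here e≡z
  z∷T⊆z∷U e (there e∈T) e≢x = there (T⊆U e e∈T e≢x)
  z∷U⊆z∷T : ∀ e → e ∈ _ ∷ _ → e ≢ y → e ∈ _ ∷ _
  z∷U⊆z∷T e (here e≡z) _    = here e≡z
  z∷U⊆z∷T e (there e∈U) e≢y = there (U⊆T e e∈U e≢y)

Flip-uncons : ∀ {z T U} → z ∉ T → z ∉ U → Flip (z ∷ T) (z ∷ U) → Flip T U
Flip-uncons {z} z∉T z∉U (x , y , x∈z∷T , x∉z∷U , y∈z∷U , y∉z∷T , T⊆U , U⊆T) =
  x , y , drop x∈z∷T (x∉z∷U ∘ here) , x∉z∷U ∘ there ,
  drop y∈z∷U (y∉z∷T ∘ here) , y∉z∷T ∘ there ,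
  (λ e e∈T e≢x → drop (T⊆U e (there e∈T) e≢x) (λ { refl → z∉T e∈T })) ,
  (λ e e∈U e≢y → drop (U⊆T e (there e∈U) e≢y) (λ { refl → z∉U e∈U }))
  where
  drop : ∀ {e S} → e ∈ z ∷ S → e ≢ z → e ∈ S
  drop (here e≡z)  e≢z = ⊥-elim (e≢z e≡z)
  drop (there e∈S) _   = e∈S

Cross-sym : ∀ {p q} → Cross p q → Cross q p
Cross-sym = Sum.swap

Cross-irrefl : ∀ {p} → ¬ Cross p p
Cross-irrefl (inj₁ (x<x , _)) = <-irrefl refl x<x
Cross-irrefl (inj₂ (x<x , _)) = <-irrefl refl x<x

from-zero-no-cross : ∀ {K c e} → e ≤ K → ¬ Cross (0 , K) (c , e)
from-zero-no-cross e≤K (inj₁ (_ , _ , K<e)) = <⇒≱ K<e e≤K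
from-zero-no-cross e≤K (inj₂ (() , _))

NonCrossing-∷ : ∀ {p S} → (∀ {q} → q ∈ S → ¬ Cross p q) → NonCrossing S → NonCrossing (p ∷ S)
NonCrossing-∷ p⋈S nc (here refl)  (here refl)  = Cross-irrefl
NonCrossing-∷ p⋈S nc (here refl)  (there q∈S)  = p⋈S q∈S
NonCrossing-∷ p⋈S nc (there p∈S)  (here refl)  = p⋈S p∈S ∘ Cross-sym
NonCrossing-∷ p⋈S nc (there p∈S)  (there q∈S)  = nc p∈S q∈S

module _ {A : Set} {P : A → Set} (P? : Decidable P) (_⊑_ : A → A → Set)
         (⊑-total : ∀ x y → x ⊑ y ⊎ y ⊑ x) (⊑-trans : ∀ {x y z} → x ⊑ y → y ⊑ z → x ⊑ z) where

  private
    ⊑-refl : ∀ x → x ⊑ x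
    ⊑-refl x = Sum.reduce (⊑-total x x)

  greatest : ∀ xs → All (¬_ ∘ P) xs ⊎ ∃ λ g → g ∈ xs × P g × (∀ {y} → y ∈ xs → P y → y ⊑ g)
  greatest []       = inj₁ []
  greatest (x ∷ xs) with P? x | greatest xs
  ... | no ¬px | inj₁ none = inj₁ (¬px ∷ none)
  ... | no ¬px | inj₂ (g , g∈ , pg , g-max) =
    inj₂ (g , there g∈ , pg , λ { (here refl) px → ⊥-elim (¬px px) ; (there y∈) py → g-max y∈ py })
  ... | yes px | inj₁ none =
    inj₂ (x , here refl , px , λ { (here refl) _ → ⊑-refl x ; (there y∈) py → ⊥-elim (All.lookup none y∈ py) })
  ... | yes px | inj₂ (g , g∈ , pg , g-max) with ⊑-total x g
  ...   | inj₁ x⊑g = inj₂ (g , there g∈ , pg , λ { (here refl) _ → x⊑g ; (there y∈) py → g-max y∈ py })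
  ...   | inj₂ g⊑x = inj₂ (x , here refl , px ,
                       λ { (here refl) _ → ⊑-refl x ; (there y∈) py → ⊑-trans (g-max y∈ py) g⊑x })

length-partition : ∀ {A : Set} {P : A → Set} (P? : Decidable P) xs →
  length xs ≡ length (filter P? xs) + length (filter (¬? ∘ P?) xs)
length-partition P? []       = refl
length-partition P? (x ∷ xs) with P? x
... | yes _ = cong suc (length-partition P? xs)
... | no  _ = trans (cong suc (length-partition P? xs)) (sym (+-suc _ _))

Chord : ℕ → ℕ → ℕ × ℕ → Set
Chord lo hi (x , y) = lo ≤ x × x + 2 ≤ y × y ≤ hi

ChordsOn : ℕ → ℕ → List (ℕ × ℕ) → Set
ChordsOn lo hi S = ∀ {p} → p ∈ S → Chord lo hi p

chord-gap : ∀ {lo hi} p → Chord lo hi p → 2 + lo ≤ hi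
chord-gap (x , y) (lo≤x , x+2≤y , y≤hi) =
  ≤-trans (+-monoʳ-≤ 2 lo≤x) (≤-trans (≤-reflexive (+-comm 2 x)) (≤-trans x+2≤y y≤hi))

-- The two sides of the longest chord (lo , j) at lo contribute at most
-- j-lo-1 and hi-j-1 chords; together with (lo , j) this is hi-lo-2.
split-count : ∀ lo j hi p q → lo + p < j → j + q < hi → suc (lo + (p + q)) < hi
split-count lo j hi p q left right = begin-strict
  suc (lo + (p + q))     ≡⟨ cong suc (+-assoc lo p q) ⟨
  suc (lo + p) + q       ≤⟨ +-monoˡ-≤ q left ⟩
  j + q                  <⟨ right ⟩
  hi                     ∎
  where open ≤-Reasoning

mutual
  -- The budget w only bounds the depth of the recursion: hi ≤ w + lo.
  chord-count : ∀ w lo hi S → hi ≤ w + lo → lo < hi →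
    Unique S → NonCrossing S → ChordsOn lo hi S → lo + length S < hi
  chord-count zero    lo hi S        budget lo<hi _ _ _ = ⊥-elim (<⇒≱ lo<hi budget)
  chord-count (suc w) lo hi []       budget lo<hi _ _ _ = subst (_< hi) (sym (+-identityʳ lo)) lo<hi
  chord-count (suc w) lo hi S@(p ∷ _) budget lo<hi unique nc chords with (lo , hi) ∈? S
  ... | no outer∉S = ≤-trans (n≤1+n _)
          (chord-count-inner w lo hi S budget (chord-gap p (chords (here refl))) unique nc chords outer∉S)
  ... | yes outer∈S with R , S↭ ← ∈⇒↭-front outer∈S =
    begin-strict
      lo + length S        ≡⟨ cong (lo +_) (↭-length S↭) ⟩
      lo + suc (length R)  ≡⟨ +-suc lo (length R) ⟩
      suc (lo + length R)  <⟨ chord-count-inner w lo hi R budget (chord-gap p (chords (here refl)))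
                                (Unique-tail outer∷R) (λ q∈ r∈ → nc (R⊆S q∈) (R⊆S r∈)) (chords ∘ R⊆S)
                                (Unique.Unique[x∷xs]⇒x∉xs outer∷R) ⟩
      hi                   ∎
    where
    open ≤-Reasoning
    outer∷R : Unique ((lo , hi) ∷ R)
    outer∷R = Unique-resp-↭ (↭⇒↭ₛ S↭) unique
    R⊆S : ∀ {q} → q ∈ R → q ∈ S
    R⊆S = ∈-resp-↭ (↭-sym S↭) ∘ there

  chord-count-inner : ∀ w lo hi R → hi ≤ suc w + lo → 2 + lo ≤ hi →
    Unique R → NonCrossing R → ChordsOn lo hi R → (lo , hi) ∉ R → suc (lo + length R) < hi
  chord-count-inner w lo hi R budget gap unique nc chords outer∉R
    with greatest (λ p → proj₁ p ≟ lo) (λ p q → proj₂ p ≤ proj₂ q) (λ p q → ≤-total _ _) ≤-trans R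
  ... | inj₁ none-at-lo =
    -- then vertex lo is unused and all chords live on lo+1,…,hi
    chord-count w (suc lo) hi R (subst (hi ≤_) (sym (+-suc w lo)) budget) gap unique nc chords′
    where
    chords′ : ChordsOn (suc lo) hi R
    chords′ {x , y} p∈ with chords p∈
    ... | lo≤x , x+2≤y , y≤hi = ≤∧≢⇒< lo≤x (λ lo≡x → All.lookup none-at-lo p∈ (sym lo≡x)) , x+2≤y , y≤hi
  ... | inj₂ ((_ , j) , longest∈ , refl , longest) =
    chord-count-split w lo hi j R budget unique nc chords longest∈ longest
      (≤∧≢⇒< (proj₂ (proj₂ (chords longest∈))) λ { refl → outer∉R longest∈ })

  -- With (lo , j) the longest chord at lo, every other chord lies on
  -- lo,…,j or on j,…,hi, since it may not cross (lo , j).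
  chord-count-split : ∀ w lo hi j R → hi ≤ suc w + lo →
    Unique R → NonCrossing R → ChordsOn lo hi R → (lo , j) ∈ R →
    (∀ {q} → q ∈ R → proj₁ q ≡ lo → proj₂ q ≤ j) → j < hi → suc (lo + length R) < hi
  chord-count-split w lo hi j R budget unique nc chords longest∈ longest j<hi =
    subst (λ ℓ → suc (lo + ℓ) < hi) (sym (length-partition inside? R))
      (split-count lo j hi (length P) (length Q)
        (chord-count w lo j P (≤-pred (≤-trans j<hi budget)) lo<j
          (Unique.filter⁺ inside? unique) (NonCrossing-filter inside? nc) chordsP)
        (chord-count w j hi Q budget′ j<hi
          (Unique.filter⁺ (¬? ∘ inside?) unique) (NonCrossing-filter (¬? ∘ inside?) nc) chordsQ))
    where
    inside? = λ (p : ℕ × ℕ) → proj₂ p ≤? j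
    P = filter inside? R
    Q = filter (¬? ∘ inside?) R
    lo<j : lo < j
    lo<j = ≤-trans (n≤1+n _) (≤-trans (≤-reflexive (+-comm 2 lo)) (proj₁ (proj₂ (chords longest∈))))
    budget′ : hi ≤ w + j
    budget′ = ≤-trans budget (≤-trans (≤-reflexive (sym (+-suc w lo))) (+-monoʳ-≤ w lo<j))
    chordsP : ChordsOn lo j P
    chordsP p∈ with p∈R , y≤j ← ∈-filter⁻ inside? p∈ with chords p∈R
    ... | lo≤x , x+2≤y , _ = lo≤x , x+2≤y , y≤j
    chordsQ : ChordsOn j hi Q
    chordsQ {x , y} p∈ with p∈R , y≰j ← ∈-filter⁻ (¬? ∘ inside?) p∈ with chords p∈R | j ≤? x
    ... | _     , x+2≤y , y≤hi | yes j≤x = j≤x , x+2≤y , y≤hi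
    ... | lo≤x  , _     , _    | no  j≰x with x ≟ lo
    ...   | yes refl = ⊥-elim (y≰j (longest p∈R refl))
    ...   | no  x≢lo = ⊥-elim (nc p∈R longest∈
                         (inj₂ (≤∧≢⇒< lo≤x (x≢lo ∘ sym) , ≰⇒> j≰x , ≰⇒> y≰j)))

noncrossing-chord-bound : ∀ {lo hi S} → lo < hi →
  Unique S → NonCrossing S → ChordsOn lo hi S → lo + length S < hi
noncrossing-chord-bound {lo} {hi} {S} = chord-count hi lo hi S (m≤m+n hi lo)

diagonal-head : ∀ {m x y} → IsDiagonal (m + 2) (x , y) → y ≤ suc m
diagonal-head {m} {y = y} (_ , y<m+2 , _) = ≤-pred (subst (y <_) (+-comm m 2) y<m+2)

side-not-diagonal : ∀ {m} → ¬ IsDiagonal (m + 2) (0 , suc m)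
side-not-diagonal {m} (_ , _ , not-side) = not-side (refl , sym (+-comm m 2))

last-head-tail : ∀ {m x} → IsDiagonal (m + 2) (x , suc m) → 0 < x
last-head-tail {x = zero}  diagonal = ⊥-elim (side-not-diagonal diagonal)
last-head-tail {x = suc x} _        = s≤s z≤n

-- A triangulation of the (m+3)-gon has m diagonals.
diagonal-count : ∀ m → suc m + 2 ∸ 3 ≡ m
diagonal-count m = cong (_∸ 2) (+-comm m 2)

outside-triangle : ∀ {k c} → ¬ (suc c ≤ k ∸ 1) → k ≤ suc c
outside-triangle {k} c≮ = ≤-trans (m≤n+m∸n k 1) (≰⇒> c≮)

InY-row : ∀ {k A c a} → InY k A → 0 < a → a ≤ d A c → suc c + a ≤ k
InY-row {k} {c = c} {a} (rows , vanish) 0<a a≤row with suc c ≤? k ∸ 1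
... | yes c<k = begin
  suc c + a           ≤⟨ +-monoʳ-≤ (suc c) (≤-trans a≤row (rows c c<k)) ⟩
  suc c + (k ∸ suc c) ≡⟨ m+[n∸m]≡n (≤-trans c<k (m∸n≤m k 1)) ⟩
  k                   ∎
  where open ≤-Reasoning
... | no  c≮k = ⊥-elim (<⇒≢ (<-≤-trans 0<a a≤row) (sym (vanish c (outside-triangle c≮k))))

InY-mono : ∀ {k k′ A} → k ≤ k′ → InY k A → InY k′ A
InY-mono {k} {k′} {A} k≤k′ (rows , vanish) = rows′ , λ i k′≤ → vanish i (≤-trans k≤k′ k′≤)
  where
  rows′ : ∀ i → suc i ≤ k′ ∸ 1 → d A i ≤ k′ ∸ suc i
  rows′ i _ with suc i ≤? k ∸ 1
  ... | yes i<k = ≤-trans (rows i i<k) (∸-monoˡ-≤ (suc i) k≤k′)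
  ... | no  i≮k = subst (_≤ k′ ∸ suc i) (sym (vanish i (outside-triangle i≮k))) z≤n

-- The two moves between the (m+3)-gon and the (m+4)-gon, both through the
-- diagonal z = (0 , m+2) cutting off the ear at the new last vertex h = m+3.
module Ear (m : ℕ) where

  z : ℕ × ℕ
  z = (0 , suc (suc m))

  h : ℕ
  h = suc (suc (suc m))

  -- In the (m+3)-gon z is a side, so it is never a diagonal there.
  z∉ : ∀ {T} → IsTriangulation (suc m + 2) T → z ∉ T
  z∉ (diagonals , _) = side-not-diagonal ∘ All.lookup diagonals

  extend : ∀ {T} → IsTriangulation (suc m + 2) T → IsTriangulation (suc (suc m) + 2) (z ∷ T)
  extend {T} T-tri@(diagonals , unique , nc , count) =
    z-diagonal ∷ All.map widen diagonals ,
    ¬Any⇒All¬ T (z∉ T-tri) ∷ unique ,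
    NonCrossing-∷ (λ q∈ → from-zero-no-cross (diagonal-head (All.lookup diagonals q∈))) nc ,
    trans (cong suc (trans count (diagonal-count m))) (sym (diagonal-count (suc m)))
    where
    z-diagonal : IsDiagonal (suc (suc m) + 2) z
    z-diagonal = s≤s (s≤s z≤n) , s≤s (s≤s (m<m+n m (s≤s z≤n))) ,
      λ (_ , last) → 1+n≢n (sym (trans (suc-injective (suc-injective last)) (+-comm m 2)))
    widen : ∀ {p} → IsDiagonal (suc m + 2) p → IsDiagonal (suc (suc m) + 2) p
    widen (x+2≤y , y<size , _) = x+2≤y , ≤-trans y<size (n≤1+n _) ,
      λ (_ , last) → <⇒≢ y<size (suc-injective last)

  -- Conversely, removing z from a triangulation of the (m+4)-gon containing
  -- it triangulates the (m+3)-gon: no remaining diagonal can reach h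
  -- without crossing z.
  restrict : ∀ {T} → IsTriangulation (suc (suc m) + 2) (z ∷ T) → IsTriangulation (suc m + 2) T
  restrict {T} (_ ∷ diagonals , z≢T ∷ unique , nc , count) =
    All.tabulate shrink-diagonal , unique , (λ p∈ q∈ → nc (there p∈) (there q∈)) ,
    trans (suc-injective (trans count (diagonal-count (suc m)))) (sym (diagonal-count m))
    where
    shrink-diagonal : ∀ {p} → p ∈ T → IsDiagonal (suc m + 2) p
    shrink-diagonal {x , y} p∈ with All.lookup diagonals p∈ | y ≟ h
    ... | diagonal@(x+2≤y , _ , _) | yes refl =
      ⊥-elim (nc (there p∈) (here refl)
        (inj₂ (last-head-tail diagonal , ≤-pred (subst (_≤ h) (+-comm x 2) x+2≤y) , ≤-refl)))
    ... | diagonal@(x+2≤y , _ , _) | no y≢h =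
      x+2≤y , subst (y <_) (sym (+-comm (suc m) 2)) (≤∧≢⇒< (diagonal-head diagonal) y≢h) ,
      λ { (refl , last) → All.lookup z≢T p∈ (cong (0 ,_) (sym (suc-injective (trans last (+-comm (suc m) 2))))) }

  -- Growing: an (m+1)-flip is an (m+2)-flip, as z leaves Λ unchanged.
  grow : ∀ {A B} → NFlip (suc m) A B → NFlip (suc (suc m)) A B
  grow (T , U , T-tri , U-tri , T↦A , U↦B , T~U) =
    z ∷ T , z ∷ U , extend T-tri , extend U-tri ,
    (λ i → trans (Λ-tail-zero (suc (suc m)) T i) (T↦A i)) ,
    (λ i → trans (Λ-tail-zero (suc (suc m)) U i) (U↦B i)) ,
    Flip-cons (z∉ T-tri) (z∉ U-tri) T~U

  -- If no diagonal ends at h and z is missing, then T and z would be m+2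
  -- non-crossing chords on the vertices 0,…,m+2, one more than possible.
  no-diagonal-at-h : ∀ {T} → IsTriangulation (suc (suc m) + 2) T → z ∉ T →
    All (λ p → proj₂ p ≢ h) T → ⊥
  no-diagonal-at-h {T} (diagonals , unique , nc , count) z∉T none-at-h =
    <-irrefl refl (subst (λ ℓ → suc ℓ < suc (suc m)) (trans count (diagonal-count (suc m)))
      (noncrossing-chord-bound (s≤s z≤n) (¬Any⇒All¬ T z∉T ∷ unique)
        (NonCrossing-∷ (from-zero-no-cross ∘ head≤) nc) chords))
    where
    head≤ : ∀ {p} → p ∈ T → proj₂ p ≤ suc (suc m)
    head≤ p∈ = ≤-pred (≤∧≢⇒< (diagonal-head (All.lookup diagonals p∈)) (All.lookup none-at-h p∈))
    chords : ChordsOn 0 (suc (suc m)) (z ∷ T)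
    chords (here refl) = z≤n , s≤s (s≤s z≤n) , ≤-refl
    chords (there p∈)  = z≤n , proj₁ (All.lookup diagonals p∈) , head≤ p∈

  -- If (a , h) is the diagonal at h with least tail, the diagonals with
  -- tail < a live on 0,…,a, so fewer than a of them exist; the others, with
  -- tail ≥ a, then push a row of Λ(T) outside the triangle of 𝕐_{m+1}.
  leftmost-at-h : ∀ {T A a} → IsTriangulation (suc (suc m) + 2) T → (a , h) ∈ T →
    (∀ {q} → q ∈ T → proj₂ q ≡ h → a ≤ proj₁ q) →
    (∀ i → Λ T i ≡ d A i) → InY (suc m) A → ⊥
  leftmost-at-h {T} {A} {a} (diagonals , unique , nc , count) a∈ leftmost T↦A A∈Y =
    <⇒≱ lower-count (+-cancelˡ-≤ (length Upper) a (length Lower) (begin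
      length Upper + a             ≤⟨ upper-count ⟩
      suc m                        ≡⟨ trans count (diagonal-count (suc m)) ⟨
      length T                     ≡⟨ length-partition upper? T ⟩
      length Upper + length Lower  ∎))
    where
    open ≤-Reasoning
    0<a : 0 < a
    0<a = last-head-tail (All.lookup diagonals a∈)
    upper? = λ (p : ℕ × ℕ) → a ≤? proj₁ p
    Upper = filter upper? T
    Lower = filter (¬? ∘ upper?) T
    chordsLower : ChordsOn 0 a Lower
    chordsLower {x , y} p∈ with p∈T , a≰x ← ∈-filter⁻ (¬? ∘ upper?) p∈ with All.lookup diagonals p∈T
    ... | diagonal@(x+2≤y , _ , _) with y ≤? a | y ≟ h
    ...   | yes y≤a | _        = z≤n , x+2≤y , y≤a
    ...   | no  _   | yes refl = ⊥-elim (a≰x (leftmost p∈T refl))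
    ...   | no  y≰a | no  y≢h  = ⊥-elim (nc p∈T a∈
             (inj₁ (≰⇒> a≰x , ≰⇒> y≰a , ≤∧≢⇒< (diagonal-head diagonal) y≢h)))
    lower-count : length Lower < a
    lower-count = noncrossing-chord-bound 0<a (Unique.filter⁺ (¬? ∘ upper?) unique)
      (NonCrossing-filter (¬? ∘ upper?) nc) chordsLower
    upper-count : length Upper + a ≤ suc m
    upper-count with length Upper in upper≡
    ... | zero  = ≤-pred (≤-pred (subst (_≤ h) (+-comm a 2) (proj₁ (All.lookup diagonals a∈))))
    ... | suc c = InY-row {A = A} A∈Y 0<a
                    (subst (a ≤_) (T↦A c) (Λ-lower-bound a c T (≤-reflexive (sym upper≡))))

  z∈ : ∀ {T A} → IsTriangulation (suc (suc m) + 2) T → (∀ i → Λ T i ≡ d A i) → InY (suc m) A → z ∈ T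
  z∈ {T} {A} T-tri T↦A A∈Y with z ∈? T
  ... | yes z∈T = z∈T
  ... | no  z∉T with greatest (λ p → proj₂ p ≟ h) (λ p q → proj₁ q ≤ proj₁ p)
                             (λ p q → ≤-total _ _) (λ q≤p r≤q → ≤-trans r≤q q≤p) T
  ...   | inj₁ none-at-h = ⊥-elim (no-diagonal-at-h T-tri z∉T none-at-h)
  ...   | inj₂ ((a , _) , a∈ , refl , leftmost) = ⊥-elim (leftmost-at-h {A = A} T-tri a∈ leftmost T↦A A∈Y)

  Without-z : List (ℕ × ℕ) → YoungDiagram → Set
  Without-z T A = ∃ λ T′ → T ↭ z ∷ T′ × z ∉ T′ × IsTriangulation (suc m + 2) T′ × (∀ i → Λ T′ i ≡ d A i)

  remove-z : ∀ {T A} → IsTriangulation (suc (suc m) + 2) T → (∀ i → Λ T i ≡ d A i) → InY (suc m) A →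
    Without-z T A
  remove-z {T} {A} T-tri T↦A A∈Y with T′ , T↭ ← ∈⇒↭-front (z∈ {A = A} T-tri T↦A A∈Y) =
    T′ , T↭ , Unique.Unique[x∷xs]⇒x∉xs (proj₁ (proj₂ z∷T′-tri)) , restrict z∷T′-tri ,
    λ i → trans (sym (trans (Λ-resp-↭ T↭ i) (Λ-tail-zero (suc (suc m)) T′ i))) (T↦A i)
    where
    z∷T′-tri = IsTriangulation-resp-↭ T↭ T-tri

  shrink : ∀ {A B} → InY (suc m) A → InY (suc m) B → NFlip (suc (suc m)) A B → NFlip (suc m) A B
  shrink {A} {B} A∈Y B∈Y (T , U , T-tri , U-tri , T↦A , U↦B , T~U) =
    flip-without-z (remove-z {A = A} T-tri T↦A A∈Y) (remove-z {A = B} U-tri U↦B B∈Y)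
    where
    flip-without-z : Without-z T A → Without-z U B → NFlip (suc m) A B
    flip-without-z (T′ , T↭ , z∉T′ , T′-tri , T′↦A) (U′ , U↭ , z∉U′ , U′-tri , U′↦B) =
      T′ , U′ , T′-tri , U′-tri , T′↦A , U′↦B , Flip-uncons z∉T′ z∉U′ (Flip-resp-↭ T↭ U↭ T~U)

grow-step : ∀ {n} A B → 1 ≤ n → NFlip n A B → NFlip (suc n) A B
grow-step {suc m} A B _ = Ear.grow m {A} {B}

shrink-step : ∀ {k} A B → 1 ≤ k → InY k A → InY k B → NFlip (suc k) A B → NFlip k A B
shrink-step {suc m} A B _ = Ear.shrink m {A} {B}

grow* : ∀ {n k} A B → 1 ≤ n → n ≤′ k → NFlip n A B → NFlip k A B
grow* A B n≥1 ≤′-refl          flip = flip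
grow* A B n≥1 (≤′-step n≤′k) flip = grow-step A B (≤-trans n≥1 (≤′⇒≤ n≤′k)) (grow* A B n≥1 n≤′k flip)

-- Iterated shrinking down to any k ≥ 1 with both diagrams in 𝕐_k; the
-- diagrams stay in 𝕐 of every intermediate size since 𝕐_k ⊆ 𝕐_j for j ≥ k.
shrink* : ∀ {k n} A B → 1 ≤ k → k ≤′ n → InY k A → InY k B → NFlip n A B → NFlip k A B
shrink* A B k≥1 ≤′-refl          A∈Y B∈Y flip = flip
shrink* A B k≥1 (≤′-step k≤′n) A∈Y B∈Y flip = shrink* A B k≥1 k≤′n A∈Y B∈Y
  (shrink-step A B (≤-trans k≥1 k≤n) (InY-mono {A = A} k≤n A∈Y) (InY-mono {A = B} k≤n B∈Y) flip)
  where k≤n = ≤′⇒≤ k≤′n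

theorem1 : (n : ℕ) → 1 ≤ n → (A B : YoungDiagram) →
    InY n A → InY n B → NFlip n A B →
    ((k : ℕ) → 1 ≤ k → InY k A → InY k B → NFlip k A B)
    × ((k : ℕ) → n < k → NFlip k A B)
theorem1 n n≥1 A B _ _ flip = any-k , above-n
  where
  any-k : (k : ℕ) → 1 ≤ k → InY k A → InY k B → NFlip k A B
  any-k k k≥1 A∈Y B∈Y with ≤-total n k
  ... | inj₁ n≤k = grow* A B n≥1 (≤⇒≤′ n≤k) flip
  ... | inj₂ k≤n = shrink* A B k≥1 (≤⇒≤′ k≤n) A∈Y B∈Y flip
  above-n : (k : ℕ) → n < k → NFlip k A B
  above-n k n<k = grow* A B n≥1 (≤⇒≤′ (<⇒≤ n<k)) flip
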